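{- Let $\kappa$ be a cardinal and let $\mathcal{G}$ be an essentially $\mathbf{A}_\kappa$ $\Omega_\kappa$ system. Then there is a cofinal subset $X\subseteq\omega^\kappa$, an order isomorphism $\varphi\colon\omega^\kappa\to X$, and isomorphisms of abelian groups $\theta_x\colon \mathbf{G}_x\to(\mathbf{A}_\kappa)_{\varphi(x)}$ for $x\in\omega^\kappa$ which are compatible with the bonding maps, i.e. for all $x\leq y$ in $\omega^\kappa$, $\theta_x\circ p_{y,x}=q_{\varphi(y),\varphi(x)}\circ\theta_y$, where $q$ denotes the bonding maps of $\mathbf{A}_\kappa$.
   Context: The set $\omega^\kappa$ is ordered pointwise. An $\Omega_\kappa$ system $\mathcal{G}$ consists of abelian groups $G_{\alpha,k}$ ($\alpha<\kappa$, $k<\omega$) and compatible homomorphisms $p_{\alpha,j,k}\colon G_{\alpha,j}\to G_{\alpha,k}$ for $j\geq k$; its associated inverse system $\mathbf{G}$ over $\omega^\kappa$ has $\mathbf{G}_x=\bigoplus_{\alpha<\kappa}G_{\alpha,x(\alpha)}$ and bonding maps $p_{y,x}=\bigoplus_\alpha p_{\alpha,y(\alpha),x(\alpha)}$ for $x\leq y$. $\mathbf{A}_\kappa$ is the system associated to the $\Omega_\kappa$ system with groups $\mathbb{Z}^k$ for all $\alpha,k$ and bonding maps the projections $\mathbb{Z}^j\to\mathbb{Z}^k$ onto the first $k$ coordinates; so $(\mathbf{A}_\kappa)_x=\bigoplus_{\alpha<\kappa}\mathbb{Z}^{x(\alpha)}$ with bonding maps $q_{y,x}$ given coordinatewise by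 these projections. $\mathcal{G}$ is essentially $\mathbf{A}_\kappa$ if there are nonzero finitely generated free abelian groups $H_{\alpha,k}$ ($\alpha<\kappa,k<\omega$) such that $G_{\alpha,k}\cong\prod_{i\leq k}H_{\alpha,i}$ for all $\alpha,k$, with the maps $p_{\alpha,j,k}$ being the canonical projections $\prod_{i\leq j}H_{\alpha,i}\to\prod_{i\leq k}H_{\alpha,i}$. -}

module Defs where

open import Level using (0ℓ)
open import Algebra.Bundles using (AbelianGroup)
open import Algebra.Structures using (IsAbelianGroup)
open import Algebra.Morphism.Structures using (module GroupMorphisms)
import Algebra.Properties.Group as GP
open import Data.Nat using (ℕ; suc; _≤_; s≤s)
open import Data.Nat.Properties using (≤-trans)
open import Data.Fin using (Fin; inject≤)
open import Data.Integer.Properties using (+-0-abelianGroup)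
open import Data.List using (List; []; _++_)
open import Data.List.Membership.Propositional using (_∈_; _∉_)
open import Data.List.Membership.Propositional.Properties using (∈-++⁺ˡ; ∈-++⁺ʳ)
open import Data.Product using (Σ; ∃; _×_; _,_; proj₁; proj₂)

open AbelianGroup using (Carrier)

IsHom : (G H : AbelianGroup 0ℓ 0ℓ) → (Carrier G → Carrier H) → Set
IsHom G H = GroupMorphisms.IsGroupHomomorphism (AbelianGroup.rawGroup G) (AbelianGroup.rawGroup H)

IsIso : (G H : AbelianGroup 0ℓ 0ℓ) → (Carrier G → Carrier H) → Set
IsIso G H = GroupMorphisms.IsGroupIsomorphism (AbelianGroup.rawGroup G) (AbelianGroup.rawGroup H)

ΠAb : (I : Set) → (I → AbelianGroup 0ℓ 0ℓ) → AbelianGroup 0ℓ 0ℓ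
ΠAb I F = record
  { Carrier = (i : I) → Carrier (F i)
  ; _≈_ = λ f g → ∀ i → AbelianGroup._≈_ (F i) (f i) (g i)
  ; _∙_ = λ f g i → AbelianGroup._∙_ (F i) (f i) (g i)
  ; ε = λ i → AbelianGroup.ε (F i)
  ; _⁻¹ = λ f i → AbelianGroup._⁻¹ (F i) (f i)
  ; isAbelianGroup = record
    { isGroup = record
      { isMonoid = record
        { isSemigroup = record
          { isMagma = record
            { isEquivalence = record
              { refl = λ i → AbelianGroup.refl (F i)
              ; sym = λ p i → AbelianGroup.sym (F i) (p i)
              ; trans = λ p q i → AbelianGroup.trans (F i) (p i) (q i) }
            ; ∙-cong = λ p q i → AbelianGroup.∙-cong (F i) (p i) (q i) }
          ; assoc = λ f g h i → AbelianGroup.assoc (F i) (f i) (g i) (h i) }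
        ; identity = (λ f i → proj₁ (AbelianGroup.identity (F i)) (f i))
                   , (λ f i → proj₂ (AbelianGroup.identity (F i)) (f i)) }
      ; inverse = (λ f i → proj₁ (AbelianGroup.inverse (F i)) (f i))
                , (λ f i → proj₂ (AbelianGroup.inverse (F i)) (f i))
      ; ⁻¹-cong = λ p i → AbelianGroup.⁻¹-cong (F i) (p i) }
    ; comm = λ f g i → AbelianGroup.comm (F i) (f i) (g i) } }

FinSupp : (I : Set) (F : I → AbelianGroup 0ℓ 0ℓ) → ((i : I) → Carrier (F i)) → Set
FinSupp I F f = ∃ λ (L : List I) → ∀ i → i ∉ L → AbelianGroup._≈_ (F i) (f i) (AbelianGroup.ε (F i))

⊕Ab : (I : Set) → (I → AbelianGroup 0ℓ 0ℓ) → AbelianGroup 0ℓ 0ℓ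
⊕Ab I F = record
  { Carrier = Σ ((i : I) → Carrier (F i)) (FinSupp I F)
  ; _≈_ = λ f g → _≈Π_ (proj₁ f) (proj₁ g)
  ; _∙_ = λ f g → (proj₁ f ∙Π proj₁ g) , ∙-supp f g
  ; ε = εΠ , ([] , λ i _ → AbelianGroup.refl (F i))
  ; _⁻¹ = λ f → (proj₁ f ⁻¹Π) , ⁻¹-supp f
  ; isAbelianGroup = record
    { isGroup = record
      { isMonoid = record
        { isSemigroup = record
          { isMagma = record
            { isEquivalence = record { refl = reflΠ ; sym = symΠ ; trans = transΠ }
            ; ∙-cong = ∙-congΠ }
          ; assoc = λ f g h → assocΠ (proj₁ f) (proj₁ g) (proj₁ h) }
        ; identity = (λ f → proj₁ identityΠ (proj₁ f)) , (λ f → proj₂ identityΠ (proj₁ f)) }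
      ; inverse = (λ f → proj₁ inverseΠ (proj₁ f)) , (λ f → proj₂ inverseΠ (proj₁ f))
      ; ⁻¹-cong = ⁻¹-congΠ }
    ; comm = λ f g → commΠ (proj₁ f) (proj₁ g) } }
  where
  open AbelianGroup (ΠAb I F) renaming
    ( _≈_ to _≈Π_; _∙_ to _∙Π_; ε to εΠ; _⁻¹ to _⁻¹Π; refl to reflΠ; sym to symΠ
    ; trans to transΠ; ∙-cong to ∙-congΠ; assoc to assocΠ; identity to identityΠ
    ; inverse to inverseΠ; ⁻¹-cong to ⁻¹-congΠ; comm to commΠ)
  C = Σ ((i : I) → Carrier (F i)) (FinSupp I F)
  ∙-supp : (f g : C) → FinSupp I F (proj₁ f ∙Π proj₁ g)
  ∙-supp (f , L , pf) (g , M , pg) = (L ++ M) , λ i i∉ →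
    let open AbelianGroup (F i) in
    trans (∙-cong (pf i (λ i∈ → i∉ (∈-++⁺ˡ i∈))) (pg i (λ i∈ → i∉ (∈-++⁺ʳ L i∈))))
          (proj₁ identity ε)
  ⁻¹-supp : (f : C) → FinSupp I F (proj₁ f ⁻¹Π)
  ⁻¹-supp (f , L , pf) = L , λ i i∉ →
    let open AbelianGroup (F i) in
    trans (⁻¹-cong (pf i i∉)) (GP.ε⁻¹≈ε (AbelianGroup.group (F i)))

⊕map : {I : Set} {F F' : I → AbelianGroup 0ℓ 0ℓ}
       (h : (i : I) → Carrier (F i) → Carrier (F' i)) →
       (∀ i {a} → AbelianGroup._≈_ (F i) a (AbelianGroup.ε (F i)) →
                  AbelianGroup._≈_ (F' i) (h i a) (AbelianGroup.ε (F' i))) →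
       Carrier (⊕Ab I F) → Carrier (⊕Ab I F')
⊕map h hε (f , L , pf) = (λ i → h i (f i)) , L , λ i i∉ → hε i (pf i i∉)

-- ω^κ with pointwise order (κ is represented by an index type K)

_≤ω_ : {K : Set} → (K → ℕ) → (K → ℕ) → Set
x ≤ω y = ∀ α → x α ≤ y α

record ΩSystem (K : Set) : Set₁ where
  field
    G     : K → ℕ → AbelianGroup 0ℓ 0ℓ
    -- p α {j} {k} (k≤j) is p_{α,j,k} : G_{α,j} → G_{α,k}
    p     : ∀ α {j k} → k ≤ j → Carrier (G α j) → Carrier (G α k)
    p-hom : ∀ α {j k} (le : k ≤ j) → IsHom (G α j) (G α k) (p α le)
    p-id  : ∀ α k (le : k ≤ k) g → AbelianGroup._≈_ (G α k) (p α le g) g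
    p-comp : ∀ α {l j k} (kj : k ≤ j) (jl : j ≤ l) (kl : k ≤ l) g →
             AbelianGroup._≈_ (G α k) (p α kj (p α jl g)) (p α kl g)

module _ {K : Set} (S : ΩSystem K) where
  open ΩSystem S

  𝐆 : (K → ℕ) → AbelianGroup 0ℓ 0ℓ
  𝐆 x = ⊕Ab K (λ α → G α (x α))

  bond : {x y : K → ℕ} → x ≤ω y → Carrier (𝐆 y) → Carrier (𝐆 x)
  bond {x} {y} le = ⊕map {F = λ α → G α (y α)} {F' = λ α → G α (x α)} (λ α → p α (le α))
                 (λ α {a} a≈ε → let open AbelianGroup (G α (x α)) in
                   trans (GroupMorphisms.IsGroupHomomorphism.⟦⟧-cong (p-hom α (le α)) a≈ε)
                         (GroupMorphisms.IsGroupHomomorphism.ε-homo (p-hom α (le α))))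

ℤ^ : ℕ → AbelianGroup 0ℓ 0ℓ
ℤ^ n = ΠAb (Fin n) (λ _ → +-0-abelianGroup)

restrict : ∀ {j k} → k ≤ j → Carrier (ℤ^ j) → Carrier (ℤ^ k)
restrict le v i = v (inject≤ i le)

𝐀 : (K : Set) → (K → ℕ) → AbelianGroup 0ℓ 0ℓ
𝐀 K x = ⊕Ab K (λ α → ℤ^ (x α))

q : {K : Set} {x y : K → ℕ} → x ≤ω y → Carrier (𝐀 K y) → Carrier (𝐀 K x)
q {K} {x} {y} le = ⊕map {F = λ α → ℤ^ (y α)} {F' = λ α → ℤ^ (x α)} (λ α → restrict (le α)) (λ α a≈ε i → a≈ε (inject≤ i (le α)))

Π≤ : (ℕ → AbelianGroup 0ℓ 0ℓ) → ℕ → AbelianGroup 0ℓ 0ℓ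
Π≤ H k = ΠAb (Σ ℕ (λ i → i ≤ k)) (λ i → H (proj₁ i))

proj≤ : (H : ℕ → AbelianGroup 0ℓ 0ℓ) {j k : ℕ} → k ≤ j → Carrier (Π≤ H j) → Carrier (Π≤ H k)
proj≤ H le v (i , i≤k) = v (i , ≤-trans i≤k le)

NonzeroFGFree : AbelianGroup 0ℓ 0ℓ → Set
NonzeroFGFree H = ∃ λ n → (1 ≤ n) × Σ (Carrier H → Carrier (ℤ^ n)) (IsIso H (ℤ^ n))

record EssentiallyA {K : Set} (S : ΩSystem K) : Set₁ where
  open ΩSystem S
  field
    H      : K → ℕ → AbelianGroup 0ℓ 0ℓ
    H-free : ∀ α i → NonzeroFGFree (H α i)
    ψ      : ∀ α k → Carrier (G α k) → Carrier (Π≤ (H α) k)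
    ψ-iso  : ∀ α k → IsIso (G α k) (Π≤ (H α) k) (ψ α k)
    ψ-comm : ∀ α {j k} (le : k ≤ j) g →
             AbelianGroup._≈_ (Π≤ (H α) k) (ψ α k (p α le g)) (proj≤ (H α) le (ψ α j g))

-- Write each H_{α,i} as ℤ^{n_{α,i}} with n_{α,i} ≥ 1. Then ∏_{i ≤ k} H_{α,i} is ℤ^{N_α(k)}
-- with N_α(k) = n_{α,0} + … + n_{α,k}, by laying the blocks end to end, and the canonical
-- projections become projections onto initial segments. So φ(x)(α) = N_α(x(α)) and the
-- coordinatewise concatenation isomorphisms do the job; N_α is strictly increasing since
-- every block is nonempty, which makes φ an order embedding with cofinal image.
module Submission where

open import Level using (0ℓ)
open import Algebra.Bundles using (AbelianGroup)
open import Algebra.Morphism.Structures using (module GroupMorphisms)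
import Algebra.Morphism.Construct.Composition as Composition
open import Data.Empty using (⊥-elim)
open import Data.Fin using (Fin; toℕ; fromℕ<; inject≤)
open import Data.Fin.Properties using (toℕ-injective; toℕ<n; toℕ-fromℕ<; toℕ-inject≤)
open import Data.Integer.Properties using (+-0-abelianGroup)
open import Data.Nat using (ℕ; zero; suc; _+_; _∸_; _≤_; _<_; _≤?_; _≤′_; ≤′-reflexive; ≤′-step; z≤n; s≤s)
open import Data.Nat.Properties
open import Data.Product using (Σ; ∃; _×_; _,_; proj₁; proj₂)
open import Function using (_∘_)
open import Relation.Binary.Definitions using (tri<; tri≈; tri>)
open import Relation.Binary.PropositionalEquality
open import Relation.Nullary using (yes; no)
open import Defs

open AbelianGroup using (Carrier)
open GroupMorphisms.IsGroupIsomorphism using (⟦⟧-cong; ε-homo)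

module _ (A B : AbelianGroup 0ℓ 0ℓ) {h : Carrier A → Carrier B} where
  private
    module A = AbelianGroup A
    module B = AbelianGroup B

  mkIsIso : (∀ {a b} → a A.≈ b → h a B.≈ h b) →
            (∀ a b → h (a A.∙ b) B.≈ h a B.∙ h b) →
            h A.ε B.≈ B.ε →
            (∀ a → h (a A.⁻¹) B.≈ h a B.⁻¹) →
            (∀ {a b} → h a B.≈ h b → a A.≈ b) →
            (∀ b → ∃ λ a → ∀ {c} → c A.≈ a → h c B.≈ b) →
            IsIso A B h
  mkIsIso cong-h ∙-homo-h ε-homo-h ⁻¹-homo-h injective-h surjective-h = record
    { isGroupMonomorphism = record
      { isGroupHomomorphism = record
        { isMonoidHomomorphism = record
          { isMagmaHomomorphism = record
            { isRelHomomorphism = record { cong = cong-h }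
            ; homo = ∙-homo-h }
          ; ε-homo = ε-homo-h }
        ; ⁻¹-homo = ⁻¹-homo-h }
      ; injective = injective-h }
    ; surjective = surjective-h }

module _ {A B : AbelianGroup 0ℓ 0ℓ} {h : Carrier A → Carrier B} where
  private
    module A = AbelianGroup A
    module B = AbelianGroup B

  isIso⇒≈ε-preserving : IsIso A B h → ∀ {a} → a A.≈ A.ε → h a B.≈ B.ε
  isIso⇒≈ε-preserving iso a≈ε = B.trans (⟦⟧-cong iso a≈ε) (ε-homo iso)

module _ {I : Set} {F F' : I → AbelianGroup 0ℓ 0ℓ} {h : ∀ i → Carrier (F i) → Carrier (F' i)}
         (iso : ∀ i → IsIso (F i) (F' i) (h i)) where
  private
    module J (i : I) = GroupMorphisms.IsGroupIsomorphism (iso i)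
    preimage : ∀ i (b : Carrier (F' i)) → Carrier (F i)
    preimage i b = proj₁ (J.surjective i b)

  ΠAb-map-isIso : IsIso (ΠAb I F) (ΠAb I F') (λ v i → h i (v i))
  ΠAb-map-isIso = mkIsIso (ΠAb I F) (ΠAb I F')
    (λ e i → J.⟦⟧-cong i (e i))
    (λ v w i → J.∙-homo i (v i) (w i))
    (λ i → J.ε-homo i)
    (λ v i → J.⁻¹-homo i (v i))
    (λ e i → J.injective i (e i))
    (λ w → (λ i → preimage i (w i)) , λ c≈ i → proj₂ (J.surjective i (w i)) (c≈ i))

  -- The preimage of a finitely supported element is supported on the same list.
  ⊕map-isIso : (hε : ∀ i {a} → AbelianGroup._≈_ (F i) a (AbelianGroup.ε (F i)) →
                                AbelianGroup._≈_ (F' i) (h i a) (AbelianGroup.ε (F' i))) →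
               IsIso (⊕Ab I F) (⊕Ab I F') (⊕map {F = F} {F' = F'} h hε)
  ⊕map-isIso hε = mkIsIso (⊕Ab I F) (⊕Ab I F')
    (λ e i → J.⟦⟧-cong i (e i))
    (λ v w i → J.∙-homo i (proj₁ v i) (proj₁ w i))
    (λ i → J.ε-homo i)
    (λ v i → J.⁻¹-homo i (proj₁ v i))
    (λ e i → J.injective i (e i))
    (λ { (w , L , w-supp) →
         ((λ i → preimage i (w i)) , L , λ i i∉L →
            J.injective i (AbelianGroup.trans (F' i)
              (proj₂ (J.surjective i (w i)) (AbelianGroup.refl (F i)))
              (AbelianGroup.trans (F' i) (w-supp i i∉L) (AbelianGroup.sym (F' i) (J.ε-homo i)))))
       , λ c≈ i → proj₂ (J.surjective i (w i)) (c≈ i) })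

module _ {f : ℕ → ℕ} where

  mono-≤-by-steps : (∀ k → f k ≤ f (suc k)) → ∀ {i j} → i ≤ j → f i ≤ f j
  mono-≤-by-steps step = go ∘ ≤⇒≤′
    where
    go : ∀ {i j} → i ≤′ j → f i ≤ f j
    go (≤′-reflexive refl) = ≤-refl
    go (≤′-step {j} i≤′j) = ≤-trans (go i≤′j) (step j)

  cancel-≤-by-steps : (∀ k → f k < f (suc k)) → ∀ {i j} → f i ≤ f j → i ≤ j
  cancel-≤-by-steps step {i} {j} fi≤fj with i ≤? j
  ... | yes i≤j = i≤j
  ... | no i≰j = ⊥-elim (<⇒≱ (<-≤-trans (step j) (mono-≤-by-steps (<⇒≤ ∘ step) (≰⇒> i≰j))) fi≤fj)

  inflationary-by-steps : (∀ k → f k < f (suc k)) → ∀ k → k ≤ f k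
  inflationary-by-steps step zero = z≤n
  inflationary-by-steps step (suc k) = ≤-trans (s≤s (inflationary-by-steps step k)) (step k)

-- A^n, so that ℤ^ n is definitionally Pow (+-0-abelianGroup) n.
Pow : AbelianGroup 0ℓ 0ℓ → ℕ → AbelianGroup 0ℓ 0ℓ
Pow A n = ΠAb (Fin n) (λ _ → A)

-- The coordinates of ∏_{i ≤ k} A^{n i} laid out as consecutive blocks of Fin (total k).
module Blocks (n : ℕ → ℕ) where

  offset : ℕ → ℕ
  offset zero = 0
  offset (suc i) = offset i + n i

  total : ℕ → ℕ
  total k = offset (suc k)

  offset-mono : ∀ {i j} → i ≤ j → offset i ≤ offset j
  offset-mono = mono-≤-by-steps (λ i → m≤m+n (offset i) (n i))

  offset+<offset+ : ∀ {i i' r r'} → r < n i → i < i' → offset i + r < offset i' + r'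
  offset+<offset+ {i} {i'} {r' = r'} r<n i<i' =
    <-≤-trans (+-monoʳ-< (offset i) r<n) (≤-trans (offset-mono i<i') (m≤m+n (offset i') r'))

  offset+-injectiveˡ : ∀ {i i' r r'} → offset i + r ≡ offset i' + r' → r < n i → r' < n i' → i ≡ i'
  offset+-injectiveˡ {i} {i'} e r<n r'<n with <-cmp i i'
  ... | tri< i<i' _ _ = ⊥-elim (<-irrefl e (offset+<offset+ r<n i<i'))
  ... | tri≈ _ i≡i' _ = i≡i'
  ... | tri> _ _ i>i' = ⊥-elim (<-irrefl (sym e) (offset+<offset+ r'<n i>i'))

  record Block (k c : ℕ) : Set where
    constructor block
    field
      index    : ℕ
      index≤k  : index ≤ k
      slot     : Fin (n index)
      position : c ≡ offset index + toℕ slot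

  lastBlock : ∀ {k c} → offset k ≤ c → c < total k → Block k c
  lastBlock {k} {c} o≤c c<total = block k ≤-refl (fromℕ< r<n) c≡
    where
    c≡o+r : c ≡ offset k + (c ∸ offset k)
    c≡o+r = sym (m+[n∸m]≡n o≤c)
    r<n : c ∸ offset k < n k
    r<n = +-cancelˡ-< (offset k) _ _ (subst (_< total k) c≡o+r c<total)
    c≡ : c ≡ offset k + toℕ (fromℕ< r<n)
    c≡ = trans c≡o+r (cong (offset k +_) (sym (toℕ-fromℕ< r<n)))

  blockOf : ∀ k {c} → c < total k → Block k c
  blockOf zero = lastBlock z≤n
  blockOf (suc k) {c} c<total with total k ≤? c
  ... | yes o≤c = lastBlock o≤c c<total
  ... | no o≰c = let block i i≤k r c≡ = blockOf k (≰⇒> o≰c) in block i (m≤n⇒m≤1+n i≤k) r c≡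

  positionOf : ∀ {k i} → i ≤ k → Fin (n i) → Fin (total k)
  positionOf {i = i} i≤k r = fromℕ< (<-≤-trans (+-monoʳ-< (offset i) (toℕ<n r)) (offset-mono (s≤s i≤k)))

  module _ (A : AbelianGroup 0ℓ 0ℓ) where
    private
      module A = AbelianGroup A

    concat : ∀ k → Carrier (Π≤ (Pow A ∘ n) k) → Carrier (Pow A (total k))
    concat k w c = let block i i≤k r _ = blockOf k (toℕ<n c) in w (i , i≤k) r

    -- The decomposition of a position into (block, slot) is unique.
    concat-at : ∀ k w {i} (i≤k : i ≤ k) (r : Fin (n i)) (c : Fin (total k)) →
                toℕ c ≡ offset i + toℕ r → concat k w c ≡ w (i , i≤k) r
    concat-at k w {i} i≤k r c c≡ with blockOf k (toℕ<n c)
    ... | block i' i'≤k r' c≡' with offset+-injectiveˡ (trans (sym c≡') c≡) (toℕ<n r') (toℕ<n r)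
    ... | refl = cong₂ (λ p s → w (i , p) s) (≤-irrelevant i'≤k i≤k)
                   (toℕ-injective (+-cancelˡ-≡ (offset i) _ _ (trans (sym c≡') c≡)))

    concat-positionOf : ∀ k w {i} (i≤k : i ≤ k) (r : Fin (n i)) →
                        concat k w (positionOf i≤k r) ≡ w (i , i≤k) r
    concat-positionOf k w i≤k r = concat-at k w i≤k r (positionOf i≤k r) (toℕ-fromℕ< _)

    concat-isIso : ∀ k → IsIso (Π≤ (Pow A ∘ n) k) (Pow A (total k)) (concat k)
    concat-isIso k = mkIsIso (Π≤ (Pow A ∘ n) k) (Pow A (total k))
      (λ e c → e _ _)
      (λ _ _ _ → A.refl)
      (λ _ → A.refl)
      (λ _ _ → A.refl)
      (λ {w} {w'} e (i , i≤k) r → A.trans (A.reflexive (sym (concat-positionOf k w i≤k r)))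
          (A.trans (e (positionOf i≤k r)) (A.reflexive (concat-positionOf k w' i≤k r))))
      (λ y → (λ (i , i≤k) r → y (positionOf i≤k r)) , λ {w} w≈ c →
          let block i i≤k r c≡ = blockOf k (toℕ<n c) in
          A.trans (w≈ (i , i≤k) r) (A.reflexive (cong y (toℕ-injective (trans (toℕ-fromℕ< _) (sym c≡))))))

    concat-proj≤ : ∀ {j k} (k≤j : k ≤ j) .(total≤ : total k ≤ total j) w (c : Fin (total k)) →
                   concat k (proj≤ (Pow A ∘ n) k≤j w) c ≡ concat j w (inject≤ c total≤)
    concat-proj≤ {j} {k} k≤j total≤ w c =
      let block i i≤k r c≡ = blockOf k (toℕ<n c) in
      sym (concat-at j w (≤-trans i≤k k≤j) r (inject≤ c total≤) (trans (toℕ-inject≤ c total≤) c≡))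

module _ {K : Set} (S : ΩSystem K) (E : EssentiallyA S) where
  open ΩSystem S
  open EssentiallyA E

  private
    ℤ-group : AbelianGroup 0ℓ 0ℓ
    ℤ-group = +-0-abelianGroup

    rank : K → ℕ → ℕ
    rank α i = proj₁ (H-free α i)

    module B (α : K) = Blocks (rank α)

    coords : ∀ α i → Carrier (H α i) → Carrier (ℤ^ (rank α i))
    coords α i = proj₁ (proj₂ (proj₂ (H-free α i)))

    coords-isIso : ∀ α i → IsIso (H α i) (ℤ^ (rank α i)) (coords α i)
    coords-isIso α i = proj₂ (proj₂ (proj₂ (H-free α i)))

    total-step : ∀ α k → B.total α k < B.total α (suc k)
    total-step α k = m<m+n (B.total α k) (proj₁ (proj₂ (H-free α (suc k))))

    flatten : ∀ α k → Carrier (Π≤ (H α) k) → Carrier (ℤ^ (B.total α k))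
    flatten α k = B.concat α ℤ-group k ∘ (λ v ip → coords α (proj₁ ip) (v ip))

    flatten-isIso : ∀ α k → IsIso (Π≤ (H α) k) (ℤ^ (B.total α k)) (flatten α k)
    flatten-isIso α k = Composition.isGroupIsomorphism (AbelianGroup.trans (ℤ^ (B.total α k)))
      (ΠAb-map-isIso {F = H α ∘ proj₁} {F' = ℤ^ ∘ rank α ∘ proj₁} (coords-isIso α ∘ proj₁))
      (B.concat-isIso α ℤ-group k)

  ω-map : (K → ℕ) → (K → ℕ)
  ω-map x α = B.total α (x α)

  ω-map-mono : ∀ {x y} → x ≤ω y → ω-map x ≤ω ω-map y
  ω-map-mono x≤y α = mono-≤-by-steps (<⇒≤ ∘ total-step α) (x≤y α)

  ω-map-cancel : ∀ x y → ω-map x ≤ω ω-map y → x ≤ω y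
  ω-map-cancel x y ωx≤ωy α = cancel-≤-by-steps (total-step α) (ωx≤ωy α)

  ω-map-inflationary : ∀ x → x ≤ω ω-map x
  ω-map-inflationary x α = inflationary-by-steps (total-step α) (x α)

  θ-coord : ∀ α k → Carrier (G α k) → Carrier (ℤ^ (B.total α k))
  θ-coord α k = flatten α k ∘ ψ α k

  θ-coord-isIso : ∀ α k → IsIso (G α k) (ℤ^ (B.total α k)) (θ-coord α k)
  θ-coord-isIso α k = Composition.isGroupIsomorphism (AbelianGroup.trans (ℤ^ (B.total α k)))
    (ψ-iso α k) (flatten-isIso α k)

  θ-coord-natural : ∀ α {j k} (k≤j : k ≤ j) (total≤ : B.total α k ≤ B.total α j) g →
    AbelianGroup._≈_ (ℤ^ (B.total α k)) (θ-coord α k (p α k≤j g)) (restrict total≤ (θ-coord α j g))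
  θ-coord-natural α k≤j total≤ g c =
    trans (⟦⟧-cong (flatten-isIso α _) (ψ-comm α k≤j g) c)
          (B.concat-proj≤ α ℤ-group k≤j total≤ (λ ip → coords α (proj₁ ip) (ψ α _ g ip)) c)

  θ-coord-≈ε : ∀ α k {g} → AbelianGroup._≈_ (G α k) g (AbelianGroup.ε (G α k)) →
    AbelianGroup._≈_ (ℤ^ (B.total α k)) (θ-coord α k g) (AbelianGroup.ε (ℤ^ (B.total α k)))
  θ-coord-≈ε α k = isIso⇒≈ε-preserving {A = G α k} {B = ℤ^ (B.total α k)} (θ-coord-isIso α k)

  θ : ∀ x → Carrier (𝐆 S x) → Carrier (𝐀 K (ω-map x))
  θ x = ⊕map {F = λ α → G α (x α)} {F' = λ α → ℤ^ (ω-map x α)}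
    (λ α → θ-coord α (x α)) (λ α → θ-coord-≈ε α (x α))

  θ-isIso : ∀ x → IsIso (𝐆 S x) (𝐀 K (ω-map x)) (θ x)
  θ-isIso x = ⊕map-isIso {F = λ α → G α (x α)} {F' = λ α → ℤ^ (ω-map x α)}
    (λ α → θ-coord-isIso α (x α)) (λ α → θ-coord-≈ε α (x α))

  θ-natural : ∀ x y (x≤y : x ≤ω y) (g : Carrier (𝐆 S y)) →
    AbelianGroup._≈_ (𝐀 K (ω-map x)) (θ x (bond S x≤y g)) (q (ω-map-mono x≤y) (θ y g))
  θ-natural x y x≤y g α = θ-coord-natural α (x≤y α) (ω-map-mono x≤y α) (proj₁ g α)

proposition3p4 : (K : Set) (S : ΩSystem K) → EssentiallyA S →
    Σ ((K → ℕ) → Set) λ X →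
    Σ ((K → ℕ) → (K → ℕ)) λ φ →
    Σ (∀ {x y} → x ≤ω y → φ x ≤ω φ y) λ φ-mono →
    (∀ x → X (φ x)) ×
    (∀ z → X z → ∃ λ x → ∀ α → φ x α ≡ z α) ×
    (∀ x y → φ x ≤ω φ y → x ≤ω y) ×
    (∀ z → ∃ λ y → X y × z ≤ω y) ×
    Σ (∀ x → AbelianGroup.Carrier (𝐆 S x) → AbelianGroup.Carrier (𝐀 K (φ x))) λ θ →
    (∀ x → IsIso (𝐆 S x) (𝐀 K (φ x)) (θ x)) ×
    (∀ x y (le : x ≤ω y) (g : AbelianGroup.Carrier (𝐆 S y)) →
    AbelianGroup._≈_ (𝐀 K (φ x)) (θ x (bond S le g)) (q (φ-mono le) (θ y g)))
proposition3p4 K S E =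
  Image , φ , ω-map-mono S E ,
  (λ x → x , λ _ → refl) ,
  (λ _ z∈Image → z∈Image) ,
  ω-map-cancel S E ,
  (λ z → φ z , (z , λ _ → refl) , ω-map-inflationary S E z) ,
  θ S E , θ-isIso S E , θ-natural S E
  where
  φ : (K → ℕ) → (K → ℕ)
  φ = ω-map S E
  Image : (K → ℕ) → Set
  Image z = ∃ λ x → ∀ α → φ x α ≡ z α
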